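{- For every infinite sequence $(a_1,a_2,a_3,\dots)$ of positive integers there exists a near-endomorphism $f:\mathbb{Z}\to\mathbb{Z}$ whose associated sequence $A_f$ is infinite and equals $(a_1,a_2,a_3,\dots)$.
   Context: A function $f:\mathbb{Z}\to\mathbb{Z}$ is a near-endomorphism if there exists a constant $C$ such that $|f(a+b)-f(a)-f(b)|<C$ for all $a,b\in\mathbb{Z}$; near-endomorphisms $f,g$ are equivalent if $f-g$ is bounded. A near-endomorphism $h$ is positive if for every $C>0$ there is $N$ with $h(n)>C$ for all $n>N$; write $h\le k$ if $k-h$ is bounded or positive, and $h<k$ if $k-h$ is positive. For a near-endomorphism $h$, its integer part $I(h)$ is the unique integer $a$ with $0\le h-a\cdot\mathrm{id}<\mathrm{id}$ in this order. For an unbounded near-endomorphism $h$, there is a near-endomorphism $k$, unique up to equivalence, with $h\circ k-\mathrm{id}$ bounded; write $h^{ -1}$ for any such $k$. The sequence $A_f$ is defined recursively: $f_1=f$, $a_1=I(f_1)$; given $f_n$ and $a_n$, if $f_n-a_n\cdot\mathrm{id}$ is bounded the sequence terminates at $a_n$; otherwise $f_{n+1}=(f_n-a_n\cdot\mathrm{id})^{ -1}$ and $a_{n+1}=I(f_{n+1})$. Then $A_f=(a_1,a_2,\dots)$ (finite or infinite). -}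

module Defs where

open import Data.Nat using (ℕ)
import Data.Nat as ℕ
open import Data.Integer using (ℤ; +_; _+_; _-_; _*_; ∣_∣; _<_; _≤_)
open import Data.Product using (Σ; ∃; _×_)
open import Data.Sum using (_⊎_)
open import Relation.Nullary using (¬_)
open import Relation.Binary.PropositionalEquality using (_≡_)

Fun : Set
Fun = ℤ → ℤ

idℤ : Fun
idℤ n = n

_⊖_ : Fun → Fun → Fun
(f ⊖ g) n = f n - g n

_·id : ℤ → Fun
(a ·id) n = a * n

zeroFun : Fun
zeroFun _ = + 0

NearEndo : Fun → Set
NearEndo f = ∃ λ (C : ℕ) → ∀ a b → ∣ f (a + b) - f a - f b ∣ ℕ.< C

Bounded : Fun → Set
Bounded h = ∃ λ (C : ℕ) → ∀ n → ∣ h n ∣ ℕ.≤ C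

Equiv : Fun → Fun → Set
Equiv f g = Bounded (f ⊖ g)

Positive : Fun → Set
Positive h = ∀ (C : ℤ) → + 0 < C → ∃ λ (N : ℤ) → ∀ n → N < n → C < h n

_≼_ : Fun → Fun → Set
h ≼ k = Bounded (k ⊖ h) ⊎ Positive (k ⊖ h)

_≺_ : Fun → Fun → Set
h ≺ k = Positive (k ⊖ h)

IsIntPart : Fun → ℤ → Set
IsIntPart h a = (zeroFun ≼ (h ⊖ (a ·id))) × ((h ⊖ (a ·id)) ≺ idℤ)

IsInverse : Fun → Fun → Set
IsInverse h k = NearEndo k × Bounded (λ n → h (k n) - n)

-- A_f is infinite and equals the sequence a (indexed from 0, i.e. a 0 = a₁):
-- there are f₁ = f, f₂, … (fs 0 = f) with aₙ = I(fₙ), fₙ - aₙ·id unbounded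
-- (so the sequence never terminates) and fₙ₊₁ = (fₙ - aₙ·id)⁻¹.
SeqInfiniteEq : Fun → (ℕ → ℤ) → Set
SeqInfiniteEq f a =
  Σ (ℕ → Fun) λ fs →
    (fs 0 ≡ f) ×
    (∀ n → NearEndo (fs n)
         × IsIntPart (fs n) (a n)
         × ¬ Bounded (fs n ⊖ (a n ·id))
         × IsInverse (fs n ⊖ (a n ·id)) (fs (ℕ.suc n)))

{-# OPTIONS --safe #-}
module Submission where

-- The sequence (a₁, a₂, …) is the continued fraction of the irrational
-- α = [a₁; a₂, …], and f is m ↦ mα up to bounded error, computed from
-- convergents: f m = ⌊m pₖ / qₖ⌋ with k = |m|.  Cross determinants of
-- convergents satisfy |pₗ qₖ − qₗ pₖ| qₖ₊₁ ≤ qₗ, which gives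
-- f m · qₗ − m pₗ = O(qₗ) uniformly in |m| ≤ l; this makes f a
-- near-endomorphism.  Doing the same for every tail αₙ = [aₙ; aₙ₊₁, …]
-- gives fₙ, and fₙ − aₙ·id approximates m (αₙ − aₙ) = m / αₙ₊₁: its slope
-- lies strictly between 0 and 1, so I(fₙ) = aₙ, and it is inverse to fₙ₊₁.

open import Defs
open import Data.Nat using (ℕ; zero; suc; z≤n; s≤s)
import Data.Nat as ℕ
import Data.Nat.Properties as ℕP
import Data.Nat.Tactic.RingSolver as ℕSolver
open import Data.Integer
  using (ℤ; +_; -[1+_]; +<+; +≤+; -≤+; _<_; _≤_; _+_; _-_; _*_; -_; ∣_∣; _/ℕ_; _%ℕ_)
  renaming (suc to sucℤ)
import Data.Integer.Properties as ℤP
open import Data.Integer.DivMod using (a≡a%ℕn+[a/ℕn]*n; n%ℕd<d)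
open import Data.Integer.Tactic.RingSolver using (solve-∀)
open import Data.Product using (Σ; _×_; _,_; proj₁; proj₂)
open import Data.Sum using (inj₂)
open import Function using (_∘_)
open import Relation.Binary.PropositionalEquality
open import Relation.Nullary using (¬_)

i≤+∣i∣ : ∀ i → i ≤ + ∣ i ∣
i≤+∣i∣ (+ n)    = ℤP.≤-refl
i≤+∣i∣ -[1+ n ] = -≤+

∣i-j-k∣≤∣i∣+∣j∣+∣k∣ : ∀ i j k → ∣ i - j - k ∣ ℕ.≤ ∣ i ∣ ℕ.+ ∣ j ∣ ℕ.+ ∣ k ∣
∣i-j-k∣≤∣i∣+∣j∣+∣k∣ i j k =
  ℕP.≤-trans (ℤP.∣i-j∣≤∣i∣+∣j∣ (i - j) k) (ℕP.+-monoˡ-≤ ∣ k ∣ (ℤP.∣i-j∣≤∣i∣+∣j∣ i j))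

*-cancelʳ-≤-pos : ∀ m n {q} → 1 ℕ.≤ q → m ℕ.* q ℕ.≤ n ℕ.* q → m ℕ.≤ n
*-cancelʳ-≤-pos m n {q} q≥1 = ℕP.*-cancelʳ-≤ m n q {{ℕ.>-nonZero q≥1}}

∣x*p-y∣≤c*p⇒y≤[x+c]*p : ∀ x y p c → ∣ x * + p - y ∣ ℕ.≤ c ℕ.* p → y ≤ (x + + c) * + p
∣x*p-y∣≤c*p⇒y≤[x+c]*p x y p c err = begin
  y                       ≡⟨ y≡[y-z]+z y (x * + p) ⟩
  (y - x * + p) + x * + p ≤⟨ ℤP.+-monoˡ-≤ (x * + p) (ℤP.≤-trans (i≤+∣i∣ (y - x * + p)) (+≤+ err′)) ⟩
  + (c ℕ.* p) + x * + p   ≡⟨ cong (_+ x * + p) (ℤP.pos-* c p) ⟩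
  + c * + p + x * + p     ≡⟨ regroup x (+ c) (+ p) ⟩
  (x + + c) * + p         ∎
  where
  open ℤP.≤-Reasoning
  y≡[y-z]+z : ∀ y z → y ≡ (y - z) + z
  y≡[y-z]+z = solve-∀
  regroup : ∀ x c p → c * p + x * p ≡ (x + c) * p
  regroup = solve-∀
  err′ : ∣ y - x * + p ∣ ℕ.≤ c ℕ.* p
  err′ = subst (ℕ._≤ c ℕ.* p) (ℤP.∣i-j∣≡∣j-i∣ (x * + p) y) err

Positive-cong : ∀ {h k : Fun} → (∀ m → h m ≡ k m) → Positive h → Positive k
Positive-cong h≗k h>0 C C>0 with h>0 C C>0
... | N , beyondN = N , λ m N<m → subst (C <_) (h≗k m) (beyondN m N<m)

positive⇒unbounded : ∀ {h} → Positive h → ¬ Bounded h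
positive⇒unbounded {h} h>0 (C , ∣h∣≤C) with h>0 (+ suc C) (+<+ (s≤s z≤n))
... | N , beyondN = ℤP.<⇒≱ (beyondN M (ℤP.suc[i]≤j⇒i<j ℤP.≤-refl)) hM≤1+C
  where
  M = sucℤ N
  hM≤1+C : h M ≤ + suc C
  hM≤1+C = ℤP.≤-trans (i≤+∣i∣ (h M)) (+≤+ (ℕP.m≤n⇒m≤1+n (∣h∣≤C M)))

-- h k ≈ k q / p, where q / p ≥ 1 / A.
positive-fromApprox : (h : Fun) (A c : ℕ) →
  (∀ k → Σ ℕ λ p → Σ ℕ λ q →
     1 ℕ.≤ q × p ℕ.≤ A ℕ.* q × ∣ h (+ k) * + p - + k * + q ∣ ℕ.≤ c ℕ.* p) →
  Positive h
positive-fromApprox h A c approx (+ b) _ =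
  + ((b ℕ.+ c) ℕ.* A) , λ { (+ k) (+<+ bound<k) → ℤP.≰⇒> (ℕP.<⇒≱ bound<k ∘ k≤bound k) }
  where
  k≤bound : ∀ k → h (+ k) ≤ + b → k ℕ.≤ (b ℕ.+ c) ℕ.* A
  k≤bound k hk≤b with approx k
  ... | p , q , q≥1 , p≤Aq , err = *-cancelʳ-≤-pos k ((b ℕ.+ c) ℕ.* A) q≥1 (begin
    k ℕ.* q                 ≤⟨ ℤP.drop‿+≤+ kq≤[b+c]p ⟩
    (b ℕ.+ c) ℕ.* p         ≤⟨ ℕP.*-monoʳ-≤ (b ℕ.+ c) p≤Aq ⟩
    (b ℕ.+ c) ℕ.* (A ℕ.* q) ≡⟨ ℕP.*-assoc (b ℕ.+ c) A q ⟨
    (b ℕ.+ c) ℕ.* A ℕ.* q   ∎)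
    where
    open ℕP.≤-Reasoning
    kq≤[b+c]p : + (k ℕ.* q) ≤ + ((b ℕ.+ c) ℕ.* p)
    kq≤[b+c]p = ZR.begin
      + (k ℕ.* q)         ZR.≡⟨ ℤP.pos-* k q ⟩
      + k * + q           ZR.≤⟨ ∣x*p-y∣≤c*p⇒y≤[x+c]*p (h (+ k)) (+ k * + q) p c err ⟩
      (h (+ k) + + c) * + p ZR.≤⟨ ℤP.*-monoʳ-≤-nonNeg (+ p) (ℤP.+-monoˡ-≤ (+ c) hk≤b) ⟩
      (+ b + + c) * + p   ZR.≡⟨ cong (_* + p) (ℤP.pos-+ b c) ⟨
      + (b ℕ.+ c) * + p   ZR.≡⟨ ℤP.pos-* (b ℕ.+ c) p ⟨
      + ((b ℕ.+ c) ℕ.* p) ZR.∎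
      where module ZR = ℤP.≤-Reasoning

nearEndo-fromApprox : (f : Fun) (num den : ℕ → ℕ) (c : ℕ) → (∀ l → 1 ℕ.≤ den l) →
  (∀ m l → ∣ m ∣ ℕ.≤ l → ∣ f m * + den l - m * + num l ∣ ℕ.≤ c ℕ.* den l) →
  NearEndo f
nearEndo-fromApprox f num den c den≥1 approx = suc (3 ℕ.* c) , λ x y → s≤s (defect≤ x y)
  where
  defect≤ : ∀ x y → ∣ f (x + y) - f x - f y ∣ ℕ.≤ 3 ℕ.* c
  defect≤ x y = *-cancelʳ-≤-pos _ (3 ℕ.* c) (den≥1 l) (begin
    ∣ defect ∣ ℕ.* q                           ≡⟨ ℤP.abs-* defect (+ q) ⟨
    ∣ defect * + q ∣                           ≡⟨ cong ∣_∣ (defect-split (f (x + y)) (f x) (f y) x y (+ q) (+ p)) ⟩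
    ∣ err (x + y) - err x - err y ∣            ≤⟨ ∣i-j-k∣≤∣i∣+∣j∣+∣k∣ (err (x + y)) (err x) (err y) ⟩
    ∣ err (x + y) ∣ ℕ.+ ∣ err x ∣ ℕ.+ ∣ err y ∣ ≤⟨ ℕP.+-mono-≤ (ℕP.+-mono-≤ errx+y errx) erry ⟩
    c ℕ.* q ℕ.+ c ℕ.* q ℕ.+ c ℕ.* q            ≡⟨ thrice c q ⟩
    3 ℕ.* c ℕ.* q                              ∎)
    where
    open ℕP.≤-Reasoning
    defect-split : ∀ fxy fx fy x y q p →
      (fxy - fx - fy) * q ≡ (fxy * q - (x + y) * p) - (fx * q - x * p) - (fy * q - y * p)
    defect-split = solve-∀
    thrice : ∀ c q → c ℕ.* q ℕ.+ c ℕ.* q ℕ.+ c ℕ.* q ≡ 3 ℕ.* c ℕ.* q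
    thrice = ℕSolver.solve-∀
    l = ∣ x ∣ ℕ.+ ∣ y ∣
    p = num l
    q = den l
    defect = f (x + y) - f x - f y
    err : ℤ → ℤ
    err m = f m * + q - m * + p
    errx+y = approx (x + y) l (ℤP.∣i+j∣≤∣i∣+∣j∣ x y)
    errx = approx x l (ℕP.m≤m+n ∣ x ∣ ∣ y ∣)
    erry = approx y l (ℕP.m≤n+m ∣ y ∣ ∣ x ∣)

module Convergents (d : ℕ → ℕ) (d≥1 : ∀ n → 1 ℕ.≤ d n) where

  -- num n k / den n k is the k-th convergent [d n; d (n + 1), …, d (n + k)].
  num den : ℕ → ℕ → ℕ
  num n zero    = d n
  num n (suc k) = d n ℕ.* num (suc n) k ℕ.+ den (suc n) k
  den n zero    = 1
  den n (suc k) = num (suc n) k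

  m≤d*m : ∀ n m → m ℕ.≤ d n ℕ.* m
  m≤d*m n m = ℕP.m≤n*m m (d n) {{ℕ.>-nonZero (d≥1 n)}}

  k<num : ∀ n k → k ℕ.< num n k
  den≥1 : ∀ n k → 1 ℕ.≤ den n k
  k<num n zero    = d≥1 n
  k<num n (suc k) = ℕP.≤-trans (ℕP.≤-reflexive (ℕP.+-comm 1 (suc k)))
    (ℕP.+-mono-≤ (ℕP.≤-trans (k<num (suc n) k) (m≤d*m n _)) (den≥1 (suc n) k))
  den≥1 n zero    = ℕP.≤-refl
  den≥1 n (suc k) = ℕP.≤-trans (s≤s z≤n) (k<num (suc n) k)

  den-nonZero : ∀ n k → ℕ.NonZero (den n k)
  den-nonZero n k = ℕ.>-nonZero (den≥1 n k)

  num≥1 : ∀ n k → 1 ℕ.≤ num n k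
  num≥1 n k = ℕP.≤-trans (s≤s z≤n) (k<num n k)

  d*den≤num : ∀ n k → d n ℕ.* den n k ℕ.≤ num n k
  d*den≤num n zero    = ℕP.≤-reflexive (ℕP.*-identityʳ _)
  d*den≤num n (suc k) = ℕP.m≤m+n _ _

  den≤num : ∀ n k → den n k ℕ.≤ num n k
  den≤num n k = ℕP.≤-trans (m≤d*m n _) (d*den≤num n k)

  num≤[1+d]*den : ∀ n k → num n k ℕ.≤ suc (d n) ℕ.* den n k
  num≤[1+d]*den n zero    = ℕP.≤-trans (ℕP.n≤1+n _) (ℕP.≤-reflexive (sym (ℕP.*-identityʳ _)))
  num≤[1+d]*den n (suc k) = begin
    d n ℕ.* p ℕ.+ den (suc n) k ≤⟨ ℕP.+-monoʳ-≤ (d n ℕ.* p) (den≤num (suc n) k) ⟩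
    d n ℕ.* p ℕ.+ p             ≡⟨ ℕP.+-comm (d n ℕ.* p) p ⟩
    suc (d n) ℕ.* p             ∎
    where
    open ℕP.≤-Reasoning
    p = num (suc n) k

  +num-suc : ∀ n k → + num n (suc k) ≡ + d n * + num (suc n) k + + den (suc n) k
  +num-suc n k = trans (ℤP.pos-+ (d n ℕ.* num (suc n) k) (den (suc n) k))
                       (cong (_+ + den (suc n) k) (ℤP.pos-* (d n) (num (suc n) k)))

  crossDet : ℕ → ℕ → ℕ → ℤ
  crossDet n k l = + num n l * + den n k - + den n l * + num n k

  crossDet-diag : ∀ n k → crossDet n k k ≡ + 0
  crossDet-diag n k = x*y-y*x≡0 (+ num n k) (+ den n k)
    where
    x*y-y*x≡0 : ∀ x y → x * y - y * x ≡ + 0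
    x*y-y*x≡0 = solve-∀

  crossDet-zero-suc : ∀ n l → crossDet n 0 (suc l) ≡ + den (suc n) l
  crossDet-zero-suc n l = begin
    + num n (suc l) * + 1 - + num (suc n) l * + d n
      ≡⟨ cong (λ z → z * + 1 - + num (suc n) l * + d n) (+num-suc n l) ⟩
    (+ d n * + num (suc n) l + + den (suc n) l) * + 1 - + num (suc n) l * + d n
      ≡⟨ cancel (+ d n) (+ num (suc n) l) (+ den (suc n) l) ⟩
    + den (suc n) l ∎
    where
    open ≡-Reasoning
    cancel : ∀ x p q → (x * p + q) * + 1 - p * x ≡ q
    cancel = solve-∀

  crossDet-suc-suc : ∀ n k l → crossDet n (suc k) (suc l) ≡ - crossDet (suc n) k l
  crossDet-suc-suc n k l = begin
    + num n (suc l) * + pk - + pl * + num n (suc k)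
      ≡⟨ cong₂ (λ u v → u * + pk - + pl * v) (+num-suc n l) (+num-suc n k) ⟩
    (+ d n * + pl + + ql) * + pk - + pl * (+ d n * + pk + + qk)
      ≡⟨ expand (+ d n) (+ pl) (+ ql) (+ pk) (+ qk) ⟩
    - (+ pl * + qk - + ql * + pk) ∎
    where
    open ≡-Reasoning
    pl = num (suc n) l
    ql = den (suc n) l
    pk = num (suc n) k
    qk = den (suc n) k
    expand : ∀ x pl ql pk qk → (x * pl + ql) * pk - pl * (x * pk + qk) ≡ - (pl * qk - ql * pk)
    expand = solve-∀

  ∣crossDet-suc-suc∣ : ∀ n k l → ∣ crossDet n (suc k) (suc l) ∣ ≡ ∣ crossDet (suc n) k l ∣
  ∣crossDet-suc-suc∣ n k l =
    trans (cong ∣_∣ (crossDet-suc-suc n k l)) (ℤP.∣-i∣≡∣i∣ (crossDet (suc n) k l))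

  -- The bound on num is only needed to carry the induction.
  crossDet-bound : ∀ n {k l} → k ℕ.≤ l →
    ∣ crossDet n k l ∣ ℕ.* den n (suc k) ℕ.≤ den n l ×
    ∣ crossDet n k l ∣ ℕ.* num n (suc k) ℕ.≤ num n l
  crossDet-bound n {l = zero} z≤n rewrite crossDet-diag n 0 = z≤n , z≤n
  crossDet-bound n {l = suc l} z≤n rewrite crossDet-zero-suc n l =
    ℕP.≤-trans (ℕP.≤-reflexive (ℕP.*-comm q (d (suc n)))) (d*den≤num (suc n) l) ,
    ℕP.≤-trans (ℕP.≤-reflexive (distrib q (d n) (d (suc n))))
      (ℕP.+-monoˡ-≤ q (ℕP.*-monoʳ-≤ (d n) (d*den≤num (suc n) l)))
    where
    q = den (suc n) l
    distrib : ∀ q x y → q ℕ.* (x ℕ.* y ℕ.+ 1) ≡ x ℕ.* (y ℕ.* q) ℕ.+ q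
    distrib = ℕSolver.solve-∀
  crossDet-bound n (s≤s {k} {l} k≤l) rewrite ∣crossDet-suc-suc∣ n k l =
    proj₂ ih ,
    ℕP.≤-trans (ℕP.≤-reflexive (distrib e (d n) (num (suc n) (suc k)) (den (suc n) (suc k))))
      (ℕP.+-mono-≤ (ℕP.*-monoʳ-≤ (d n) (proj₂ ih)) (proj₁ ih))
    where
    ih = crossDet-bound (suc n) k≤l
    e = ∣ crossDet (suc n) k l ∣
    distrib : ∀ e x p q → e ℕ.* (x ℕ.* p ℕ.+ q) ≡ x ℕ.* (e ℕ.* p) ℕ.+ e ℕ.* q
    distrib = ℕSolver.solve-∀

  den≤num∸den : ∀ n k → den (suc n) k ℕ.≤ num n (suc k) ℕ.∸ den n (suc k)
  den≤num∸den n k = ℕP.≤-trans (ℕP.≤-reflexive (sym (ℕP.m+n∸m≡n p q)))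
                                (ℕP.∸-monoˡ-≤ p (ℕP.+-monoˡ-≤ q (m≤d*m n p)))
    where
    p = num (suc n) k
    q = den (suc n) k

  num≤A*[num∸den] : ∀ n k →
    num n (suc k) ℕ.≤ suc (d n) ℕ.* suc (d (suc n)) ℕ.* (num n (suc k) ℕ.∸ den n (suc k))
  num≤A*[num∸den] n k = begin
    num n (suc k)                        ≤⟨ num≤[1+d]*den n (suc k) ⟩
    suc (d n) ℕ.* num (suc n) k          ≤⟨ ℕP.*-monoʳ-≤ (suc (d n)) (num≤[1+d]*den (suc n) k) ⟩
    suc (d n) ℕ.* (suc (d (suc n)) ℕ.* den (suc n) k)
      ≤⟨ ℕP.*-monoʳ-≤ (suc (d n)) (ℕP.*-monoʳ-≤ (suc (d (suc n))) (den≤num∸den n k)) ⟩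
    suc (d n) ℕ.* (suc (d (suc n)) ℕ.* (num n (suc k) ℕ.∸ den n (suc k)))
      ≡⟨ ℕP.*-assoc (suc (d n)) (suc (d (suc n))) _ ⟨
    suc (d n) ℕ.* suc (d (suc n)) ℕ.* (num n (suc k) ℕ.∸ den n (suc k)) ∎
    where open ℕP.≤-Reasoning

  ∣m*crossDet∣≤den : ∀ n m l → ∣ m ∣ ℕ.≤ l → ∣ m * crossDet n (∣ m ∣) l ∣ ℕ.≤ den n l
  ∣m*crossDet∣≤den n m l k≤l = begin
    ∣ m * crossDet n k l ∣ ≡⟨ ℤP.abs-* m (crossDet n k l) ⟩
    k ℕ.* e                ≤⟨ ℕP.*-monoˡ-≤ e (ℕP.<⇒≤ (k<num (suc n) k)) ⟩
    den n (suc k) ℕ.* e    ≡⟨ ℕP.*-comm (den n (suc k)) e ⟩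
    e ℕ.* den n (suc k)    ≤⟨ proj₁ (crossDet-bound n k≤l) ⟩
    den n l                ∎
    where
    open ℕP.≤-Reasoning
    k = ∣ m ∣
    e = ∣ crossDet n k l ∣

  approx : ℕ → Fun
  approx n m = (m * + num n ∣ m ∣) /ℕ den n ∣ m ∣
    where instance _ = den-nonZero n ∣ m ∣

  approx-error : ∀ n m l → ∣ m ∣ ℕ.≤ l →
    ∣ approx n m * + den n l - m * + num n l ∣ ℕ.≤ 2 ℕ.* den n l
  approx-error n m l k≤l = *-cancelʳ-≤-pos ∣ err ∣ (2 ℕ.* ql) (den≥1 n k) (begin
    ∣ err ∣ ℕ.* qk                          ≡⟨ ℤP.abs-* err (+ qk) ⟨
    ∣ err * + qk ∣                          ≡⟨ cong ∣_∣ err*qk≡ ⟩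
    ∣ - (+ r * + ql) - mE ∣                 ≤⟨ ℤP.∣i-j∣≤∣i∣+∣j∣ (- (+ r * + ql)) mE ⟩
    ∣ - (+ r * + ql) ∣ ℕ.+ ∣ mE ∣            ≡⟨ cong (ℕ._+ ∣ mE ∣) ∣-rql∣≡rql ⟩
    r ℕ.* ql ℕ.+ ∣ mE ∣
      ≤⟨ ℕP.+-mono-≤ (ℕP.*-monoˡ-≤ ql (ℕP.<⇒≤ r<qk)) (∣m*crossDet∣≤den n m l k≤l) ⟩
    qk ℕ.* ql ℕ.+ ql                        ≤⟨ ℕP.+-monoʳ-≤ (qk ℕ.* ql) (ℕP.m≤m*n ql qk) ⟩
    qk ℕ.* ql ℕ.+ ql ℕ.* qk                 ≡⟨ twice qk ql ⟩
    2 ℕ.* ql ℕ.* qk                         ∎)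
    where
    open ℕP.≤-Reasoning
    k = ∣ m ∣
    pk = num n k
    qk = den n k
    instance _ = den-nonZero n k
    pl = num n l
    ql = den n l
    y = approx n m
    r = (m * + pk) %ℕ qk
    r<qk : r ℕ.< qk
    r<qk = n%ℕd<d (m * + pk) qk
    err = y * + ql - m * + pl
    mE = m * crossDet n k l
    ∣-rql∣≡rql : ∣ - (+ r * + ql) ∣ ≡ r ℕ.* ql
    ∣-rql∣≡rql = trans (ℤP.∣-i∣≡∣i∣ (+ r * + ql)) (ℤP.abs-* (+ r) (+ ql))
    split : ∀ y m r qk pl ql →
      (y * ql - m * pl) * qk ≡ ql * (r + y * qk) - m * pl * qk - r * ql
    split = solve-∀
    regroup : ∀ m r pk qk pl ql →
      ql * (m * pk) - m * pl * qk - r * ql ≡ - (r * ql) - m * (pl * qk - ql * pk)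
    regroup = solve-∀
    twice : ∀ a b → a ℕ.* b ℕ.+ b ℕ.* a ≡ 2 ℕ.* b ℕ.* a
    twice = ℕSolver.solve-∀
    err*qk≡ : err * + qk ≡ - (+ r * + ql) - mE
    err*qk≡ = ≡.begin
      err * + qk
        ≡.≡⟨ split y m (+ r) (+ qk) (+ pl) (+ ql) ⟩
      + ql * (+ r + y * + qk) - m * + pl * + qk - + r * + ql
        ≡.≡⟨ cong (λ t → + ql * t - m * + pl * + qk - + r * + ql) (a≡a%ℕn+[a/ℕn]*n (m * + pk) qk) ⟨
      + ql * (m * + pk) - m * + pl * + qk - + r * + ql
        ≡.≡⟨ regroup m (+ r) (+ pk) (+ qk) (+ pl) (+ ql) ⟩
      - (+ r * + ql) - mE                                 ≡.∎
      where module ≡ = ≡-Reasoning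

  approx-nearEndo : ∀ n → NearEndo (approx n)
  approx-nearEndo n = nearEndo-fromApprox (approx n) (num n) (den n) 2 (den≥1 n) (approx-error n)

  fracPart : ℕ → Fun
  fracPart n = approx n ⊖ ((+ d n) ·id)

  fracPart-error : ∀ n m l → ∣ m ∣ ℕ.≤ suc l →
    ∣ fracPart n m * + num (suc n) l - m * + den (suc n) l ∣ ℕ.≤ 2 ℕ.* num (suc n) l
  fracPart-error n m l k≤1+l =
    subst (ℕ._≤ 2 ℕ.* p) (cong ∣_∣ shift) (approx-error n m (suc l) k≤1+l)
    where
    open ≡-Reasoning
    p = num (suc n) l
    q = den (suc n) l
    regroup : ∀ f m x p q → f * p - m * (x * p + q) ≡ (f - x * m) * p - m * q
    regroup = solve-∀
    shift : approx n m * + p - m * + num n (suc l) ≡ fracPart n m * + p - m * + q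
    shift = begin
      approx n m * + p - m * + num n (suc l)
        ≡⟨ cong (λ z → approx n m * + p - m * z) (+num-suc n l) ⟩
      approx n m * + p - m * (+ d n * + p + + q)
        ≡⟨ regroup (approx n m) m (+ d n) (+ p) (+ q) ⟩
      (approx n m - + d n * m) * + p - m * + q ∎

  fracPart-inverse : ∀ n m → ∣ fracPart n (approx (suc n) m) - m ∣ ℕ.≤ 4
  fracPart-inverse n m = *-cancelʳ-≤-pos ∣ G - m ∣ 4 (num≥1 (suc n) l) (begin
    ∣ G - m ∣ ℕ.* p                                   ≡⟨ ℤP.abs-* (G - m) (+ p) ⟨
    ∣ (G - m) * + p ∣                                 ≡⟨ cong ∣_∣ (split G j m (+ p) (+ q)) ⟩
    ∣ (G * + p - j * + q) + (j * + q - m * + p) ∣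
      ≤⟨ ℤP.∣i+j∣≤∣i∣+∣j∣ (G * + p - j * + q) (j * + q - m * + p) ⟩
    ∣ G * + p - j * + q ∣ ℕ.+ ∣ j * + q - m * + p ∣    ≤⟨ ℕP.+-mono-≤ errG errj ⟩
    2 ℕ.* p ℕ.+ 2 ℕ.* q
      ≤⟨ ℕP.+-monoʳ-≤ (2 ℕ.* p) (ℕP.*-monoʳ-≤ 2 (den≤num (suc n) l)) ⟩
    2 ℕ.* p ℕ.+ 2 ℕ.* p                               ≡⟨ twice p ⟩
    4 ℕ.* p                                           ∎)
    where
    open ℕP.≤-Reasoning
    j = approx (suc n) m
    G = fracPart n j
    l = ∣ m ∣ ℕ.+ ∣ j ∣
    p = num (suc n) l
    q = den (suc n) l
    errj = approx-error (suc n) m l (ℕP.m≤m+n ∣ m ∣ ∣ j ∣)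
    errG = fracPart-error n j l (ℕP.m≤n⇒m≤1+n (ℕP.m≤n+m ∣ j ∣ ∣ m ∣))
    split : ∀ G j m p q → (G - m) * p ≡ (G * p - j * q) + (j * q - m * p)
    split = solve-∀
    twice : ∀ p → 2 ℕ.* p ℕ.+ 2 ℕ.* p ≡ 4 ℕ.* p
    twice = ℕSolver.solve-∀

  fracPart-positive : ∀ n → Positive (fracPart n)
  fracPart-positive n = positive-fromApprox (fracPart n) (suc (d (suc n))) 2 λ k →
    num (suc n) k , den (suc n) k , den≥1 (suc n) k , num≤[1+d]*den (suc n) k ,
    fracPart-error n (+ k) k (ℕP.n≤1+n k)

  -- Slope 1 − 1/αₙ₊₁, read off as (p − q)/p from the convergents p/q of αₙ₊₁.
  fracPart<id : ∀ n → Positive (λ m → m - fracPart n m)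
  fracPart<id n = positive-fromApprox (λ m → m - fracPart n m)
    (suc (d (suc n)) ℕ.* suc (d (suc (suc n)))) 2 λ k →
      p k , p k ℕ.∸ q k , ℕP.≤-trans (den≥1 (suc (suc n)) k) (den≤num∸den (suc n) k) ,
      num≤A*[num∸den] (suc n) k , err k
    where
    p q : ℕ → ℕ
    p k = num (suc n) (suc k)
    q k = den (suc n) (suc k)
    regroup : ∀ k G p q → (k - G) * p - k * (p - q) ≡ - (G * p - k * q)
    regroup = solve-∀
    err : ∀ k → ∣ (+ k - fracPart n (+ k)) * + p k - + k * + (p k ℕ.∸ q k) ∣ ℕ.≤ 2 ℕ.* p k
    err k = subst (ℕ._≤ 2 ℕ.* p k) (sym ∣err∣≡)
                  (fracPart-error n (+ k) (suc k) (ℕP.m≤n⇒m≤1+n (ℕP.n≤1+n k)))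
      where
      open ≡-Reasoning
      G = fracPart n (+ k)
      +[p∸q]≡ : + (p k ℕ.∸ q k) ≡ + p k - + q k
      +[p∸q]≡ = sym (trans (ℤP.m-n≡m⊖n (p k) (q k)) (ℤP.⊖-≥ (den≤num (suc n) (suc k))))
      ∣err∣≡ : ∣ (+ k - G) * + p k - + k * + (p k ℕ.∸ q k) ∣ ≡ ∣ G * + p k - + k * + q k ∣
      ∣err∣≡ = begin
        ∣ (+ k - G) * + p k - + k * + (p k ℕ.∸ q k) ∣
          ≡⟨ cong (λ z → ∣ (+ k - G) * + p k - + k * z ∣) +[p∸q]≡ ⟩
        ∣ (+ k - G) * + p k - + k * (+ p k - + q k) ∣
          ≡⟨ cong ∣_∣ (regroup (+ k) G (+ p k) (+ q k)) ⟩
        ∣ - (G * + p k - + k * + q k) ∣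
          ≡⟨ ℤP.∣-i∣≡∣i∣ (G * + p k - + k * + q k) ⟩
        ∣ G * + p k - + k * + q k ∣ ∎

  approx-intPart : ∀ n → IsIntPart (approx n) (+ d n)
  approx-intPart n =
    inj₂ (Positive-cong (λ m → sym (ℤP.+-identityʳ (fracPart n m))) (fracPart-positive n)) ,
    fracPart<id n

  approx-inverse : ∀ n → IsInverse (fracPart n) (approx (suc n))
  approx-inverse n = approx-nearEndo (suc n) , 4 , fracPart-inverse n

mainTheorem8 : (a : ℕ → ℤ) → (∀ n → + 0 < a n) →
    Σ (ℤ → ℤ) λ f → NearEndo f × SeqInfiniteEq f a
mainTheorem8 a a>0 = approx 0 , approx-nearEndo 0 , approx , refl , λ n →
  approx-nearEndo n ,
  subst (Step n) (ℤP.0≤i⇒+∣i∣≡i (ℤP.<⇒≤ (a>0 n)))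
    (approx-intPart n , positive⇒unbounded (fracPart-positive n) , approx-inverse n)
  where
  ∣i∣≥1 : ∀ {i} → + 0 < i → 1 ℕ.≤ ∣ i ∣
  ∣i∣≥1 (+<+ 0<i) = 0<i
  open Convergents (λ n → ∣ a n ∣) (λ n → ∣i∣≥1 (a>0 n))
  Step : ℕ → ℤ → Set
  Step n c = IsIntPart (approx n) c × ¬ Bounded (approx n ⊖ (c ·id))
           × IsInverse (approx n ⊖ (c ·id)) (approx (suc n))
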